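{- The functor $\mathbf{T}:\mathbb{SRL}\to\mathfrak{T}$ is full: for all Stonean residuated lattices $\mathbf{A}_1,\mathbf{A}_2$ and every morphism $(h,k):(\mathbf{B}(\mathbf{A}_1),\mathbf{D}(\mathbf{A}_1),\phi_{\mathbf{A}_1})\to(\mathbf{B}(\mathbf{A}_2),\mathbf{D}(\mathbf{A}_2),\phi_{\mathbf{A}_2})$ in $\mathfrak{T}$ there is a homomorphism $f:\mathbf{A}_1\to\mathbf{A}_2$ with $f\restriction_{B(\mathbf{A}_1)}=h$ and $f\restriction_{D(\mathbf{A}_1)}=k$.
   Context: A residuated lattice is an algebra $(A,\ast,\to,\vee,\wedge,\top)$ with $(A,\ast,\top)$ a commutative monoid, $(A,\vee,\wedge)$ a lattice with top $\top$, and $x\ast y\le z$ iff $x\le y\to z$. A bounded residuated lattice also has a least element $\bot$ as constant; $\neg x:=x\to\bot$. Dense elements: $\neg x=\bot$, forming a residuated lattice $\mathbf{D}(\mathbf{A})$. Boolean elements: $x\vee\neg x=\top$, $x\wedge\neg x=\bot$, forming a Boolean algebra $\mathbf{B}(\mathbf{A})$. Stonean: bounded residuated lattice satisfying $\neg x\vee\neg\neg x=\top$; $\mathbb{SRL}$ is the category of Stonean residuated lattices and homomorphisms. i-filters of $\mathbf{D}$: subsets $F\ni\top$ with $x,x\to y\in F\Rightarrow y\in F$; $\mathcal{F}_i(\mathbf{D})$ their lattice under inclusion. $\phi_{\mathbf{A}}(a)=\{x\in D(\mathbf{A}):x\ge\neg a\}$ for $a\in B(\mathbf{A})$. In the category $\mathfrak{T}$,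 objects are $(\mathbf{B},\mathbf{D},\phi)$ with $\mathbf{B}$ Boolean algebra, $\mathbf{D}$ residuated lattice, $\phi:\mathbf{B}\to\mathcal{F}_i(\mathbf{D})$ a bounded lattice homomorphism; morphisms are pairs $(h,k)$, $h$ a Boolean homomorphism, $k$ a residuated lattice homomorphism, with $k(\phi_1(a))\subseteq\phi_2(h(a))$ for all $a$. The functor $\mathbf{T}$ sends $\mathbf{A}$ to $(\mathbf{B}(\mathbf{A}),\mathbf{D}(\mathbf{A}),\phi_{\mathbf{A}})$ and $f$ to $(f\restriction_{B(\mathbf{A}_1)},f\restriction_{D(\mathbf{A}_1)})$. -}

module Defs where

open import Level using (Level; _⊔_; suc)
open import Data.Product using (Σ; Σ-syntax; _×_; _,_; proj₁; proj₂; ∃)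
open import Function using (_⇔_)
open import Relation.Binary.PropositionalEquality using (_≡_)
open import Algebra.Structures using (IsCommutativeMonoid)
open import Algebra.Lattice.Structures using (IsLattice)

record BoundedResLattice (c : Level) : Set (suc c) where
  infixr 5 _⇒_
  infixl 7 _*_
  infixl 6 _∧_
  infixl 5 _∨_
  infix  4 _≤_
  field
    Carrier : Set c
    _*_ _⇒_ _∨_ _∧_ : Carrier → Carrier → Carrier
    ⊤ ⊥ : Carrier
  _≤_ : Carrier → Carrier → Set c
  x ≤ y = x ∧ y ≡ x
  field
    *-isCommutativeMonoid : IsCommutativeMonoid _≡_ _*_ ⊤
    isLattice : IsLattice _≡_ _∨_ _∧_
    ⊤-top : ∀ x → x ≤ ⊤
    ⊥-bottom : ∀ x → ⊥ ≤ x
    residuation : ∀ x y z → (x * y ≤ z) ⇔ (x ≤ y ⇒ z)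

  ¬_ : Carrier → Carrier
  ¬ x = x ⇒ ⊥

  IsDense : Carrier → Set c
  IsDense x = ¬ x ≡ ⊥

  IsBoolean : Carrier → Set c
  IsBoolean x = (x ∨ ¬ x ≡ ⊤) × (x ∧ ¬ x ≡ ⊥)

  D : Set c
  D = Σ Carrier IsDense

  B : Set c
  B = Σ Carrier IsBoolean

  _∈φ_ : D → B → Set c
  x ∈φ a = ¬ proj₁ a ≤ proj₁ x

open BoundedResLattice public using (Carrier; D; B)

IsStonean : ∀ {c} → BoundedResLattice c → Set c
IsStonean A = ∀ x → (¬ x) ∨ (¬ (¬ x)) ≡ ⊤
  where open BoundedResLattice A

module _ {a b : Level} (A₁ : BoundedResLattice a) (A₂ : BoundedResLattice b) where
  private
    module A₁ = BoundedResLattice A₁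
    module A₂ = BoundedResLattice A₂

  IsBRLHom : (A₁.Carrier → A₂.Carrier) → Set (a ⊔ b)
  IsBRLHom f =
      (∀ x y → f (x A₁.* y) ≡ f x A₂.* f y)
    × (∀ x y → f (x A₁.⇒ y) ≡ f x A₂.⇒ f y)
    × (∀ x y → f (x A₁.∨ y) ≡ f x A₂.∨ f y)
    × (∀ x y → f (x A₁.∧ y) ≡ f x A₂.∧ f y)
    × (f A₁.⊤ ≡ A₂.⊤)
    × (f A₁.⊥ ≡ A₂.⊥)

  -- The operations of B(A) are the
  -- restrictions of ∨, ∧, ¬, ⊤, ⊥ of A; preservation is phrased on underlying
  -- elements: whenever z = x ∘ y in A (with x, y, z Boolean), h z = h x ∘ h y.
  IsBoolHom : (A₁.B → A₂.B) → Set (a ⊔ b)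
  IsBoolHom h =
      (∀ (x y z : A₁.B) → proj₁ z ≡ proj₁ x A₁.∨ proj₁ y
                       → proj₁ (h z) ≡ proj₁ (h x) A₂.∨ proj₁ (h y))
    × (∀ (x y z : A₁.B) → proj₁ z ≡ proj₁ x A₁.∧ proj₁ y
                       → proj₁ (h z) ≡ proj₁ (h x) A₂.∧ proj₁ (h y))
    × (∀ (x z : A₁.B) → proj₁ z ≡ A₁.¬ proj₁ x
                     → proj₁ (h z) ≡ A₂.¬ proj₁ (h x))
    × (∀ (z : A₁.B) → proj₁ z ≡ A₁.⊤ → proj₁ (h z) ≡ A₂.⊤)
    × (∀ (z : A₁.B) → proj₁ z ≡ A₁.⊥ → proj₁ (h z) ≡ A₂.⊥)

  -- residuated-lattice homomorphism D(A₁) → D(A₂) (operations *, ⇒, ∨, ∧, ⊤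
  -- of D(A) are the restrictions of those of A), phrased the same way.
  IsResLatHomD : (A₁.D → A₂.D) → Set (a ⊔ b)
  IsResLatHomD k =
      (∀ (x y z : A₁.D) → proj₁ z ≡ proj₁ x A₁.* proj₁ y
                       → proj₁ (k z) ≡ proj₁ (k x) A₂.* proj₁ (k y))
    × (∀ (x y z : A₁.D) → proj₁ z ≡ proj₁ x A₁.⇒ proj₁ y
                       → proj₁ (k z) ≡ proj₁ (k x) A₂.⇒ proj₁ (k y))
    × (∀ (x y z : A₁.D) → proj₁ z ≡ proj₁ x A₁.∨ proj₁ y
                       → proj₁ (k z) ≡ proj₁ (k x) A₂.∨ proj₁ (k y))
    × (∀ (x y z : A₁.D) → proj₁ z ≡ proj₁ x A₁.∧ proj₁ y
                       → proj₁ (k z) ≡ proj₁ (k x) A₂.∧ proj₁ (k y))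
    × (∀ (z : A₁.D) → proj₁ z ≡ A₁.⊤ → proj₁ (k z) ≡ A₂.⊤)

  record TMorphism : Set (a ⊔ b) where
    field
      h : A₁.B → A₂.B
      k : A₁.D → A₂.D
      h-hom : IsBoolHom h
      k-hom : IsResLatHomD k
      compat : ∀ (a′ : A₁.B) (x : A₁.D) → x A₁.∈φ a′ → k x A₂.∈φ h a′

-- Stonean-ness of A₁ splits every x as  x = ¬¬x ∧ (x ∨ ¬x)  with ¬¬x Boolean and x ∨ ¬x dense,
-- which forces  f x = h (¬¬x) ∧ k (x ∨ ¬x) .  The heart of the proof is that  f (p ∧ e) = h p ∧ k e
-- for every Boolean p and dense e, i.e. that  (p , e) ↦ h p ∧ k e  is monotone; this is where the
-- compatibility of k with φ enters, since  p ∧ e ≤ ε  puts  e ⇒ ε  into  φ (¬ p) .  Preservation of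
-- ∧, * and the constants is then a computation, and ∨, ⇒ follow by splitting on the Boolean
-- elements h (¬¬x), h (¬¬y): for complemented u,  t ≤ w  as soon as  u ∧ t ≤ w  and  ¬u ∧ t ≤ w .
module Submission where

open import Defs
open import Level using (Level)
open import Data.Product using (Σ; _×_; _,_; proj₁; proj₂)
open import Function using (Equivalence)
open import Relation.Binary.PropositionalEquality
  using (_≡_; refl; sym; trans; cong; cong₂; subst; isEquivalence; module ≡-Reasoning)
open import Relation.Binary.Structures using (IsPartialOrder)
open import Algebra.Bundles using (CommutativeMonoid; CommutativeSemigroup)
open import Algebra.Structures using (IsCommutativeBand)
open import Algebra.Lattice.Bundles using (Lattice)
open import Algebra.Lattice.Structures using (IsLattice)
import Algebra.Lattice.Properties.Lattice as LatticeProperties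
import Algebra.Properties.CommutativeSemigroup as CommutativeSemigroupProperties
import Relation.Binary.Lattice as Order
import Relation.Binary.Lattice.Properties.JoinSemilattice as JoinSemilatticeProperties
import Relation.Binary.Lattice.Properties.MeetSemilattice as MeetSemilatticeProperties
import Relation.Binary.Reasoning.PartialOrder as PartialOrderReasoning

module ResiduatedLatticeProperties {c : Level} (A : BoundedResLattice c) where
  open BoundedResLattice A hiding (B; D)

  private
    lattice : Lattice c c
    lattice = record { isLattice = isLattice }

    -- The library orders a lattice by  x ≡ x ∧ y , the converse equation of  _≤_ .
    module Natural = Order.IsLattice (LatticeProperties.∨-∧-isOrderTheoreticLattice lattice)

  ≤-isPartialOrder : IsPartialOrder _≡_ _≤_
  ≤-isPartialOrder = record
    { isPreorder = record
      { isEquivalence = isEquivalence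
      ; reflexive     = λ x≡y → sym (Natural.reflexive x≡y)
      ; trans         = λ x≤y y≤z → sym (Natural.trans (sym x≤y) (sym y≤z))
      }
    ; antisym = λ x≤y y≤x → Natural.antisym (sym x≤y) (sym y≤x)
    }

  ≤-isLattice : Order.IsLattice _≡_ _≤_ _∨_ _∧_
  ≤-isLattice = record
    { isPartialOrder = ≤-isPartialOrder
    ; supremum = λ x y → let ub₁ , ub₂ , least = Natural.supremum x y
                         in sym ub₁ , sym ub₂ , λ z p q → sym (least z (sym p) (sym q))
    ; infimum  = λ x y → let lb₁ , lb₂ , greatest = Natural.infimum x y
                         in sym lb₁ , sym lb₂ , λ z p q → sym (greatest z (sym p) (sym q))
    }

  ≤-lattice : Order.Lattice c c c
  ≤-lattice = record { isLattice = ≤-isLattice }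

  open Order.IsLattice ≤-isLattice public
    using (x≤x∨y; y≤x∨y; ∨-least; x∧y≤x; x∧y≤y; ∧-greatest)
    renaming (refl to ≤-refl; reflexive to ≤-reflexive; trans to ≤-trans; antisym to ≤-antisym)
  open JoinSemilatticeProperties (Order.Lattice.joinSemilattice ≤-lattice) public
    using (∨-monotonic)
  open MeetSemilatticeProperties (Order.Lattice.meetSemilattice ≤-lattice) public
    using (∧-monotonic)
  open IsLattice isLattice public using (∨-comm; ∧-comm)

  module ≤-Reasoning = PartialOrderReasoning (Order.Lattice.poset ≤-lattice)
  open ≤-Reasoning

  ∧-commutativeSemigroup : CommutativeSemigroup c c
  ∧-commutativeSemigroup = record
    { isCommutativeSemigroup =
        IsCommutativeBand.isCommutativeSemigroup (LatticeProperties.∧-isSemilattice lattice)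
    }

  *-commutativeMonoid : CommutativeMonoid c c
  *-commutativeMonoid = record { isCommutativeMonoid = *-isCommutativeMonoid }

  module ∧-Properties = CommutativeSemigroupProperties ∧-commutativeSemigroup
  module *-Properties =
    CommutativeSemigroupProperties (CommutativeMonoid.commutativeSemigroup *-commutativeMonoid)

  open CommutativeMonoid *-commutativeMonoid public
    using () renaming (comm to *-comm; assoc to *-assoc; identityʳ to *-identityʳ)

  -- Proofs are opaque: otherwise comparing two elements of B A or D A unfolds their membership
  -- proofs, and checking the homomorphism laws below takes minutes.
  opaque
    ∧-identityʳ : ∀ x → x ∧ ⊤ ≡ x
    ∧-identityʳ = ⊤-top

    ∧-identityˡ : ∀ x → ⊤ ∧ x ≡ x
    ∧-identityˡ x = trans (∧-comm ⊤ x) (⊤-top x)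

    ⊤≤⇒≡⊤ : ∀ {x} → ⊤ ≤ x → x ≡ ⊤
    ⊤≤⇒≡⊤ {x} ⊤≤x = ≤-antisym (⊤-top x) ⊤≤x

    ≤⊥⇒≡⊥ : ∀ {x} → x ≤ ⊥ → x ≡ ⊥
    ≤⊥⇒≡⊥ {x} x≤⊥ = ≤-antisym x≤⊥ (⊥-bottom x)

    residuate : ∀ {x y z} → x * y ≤ z → x ≤ y ⇒ z
    residuate = Equivalence.to (residuation _ _ _)

    unresiduate : ∀ {x y z} → x ≤ y ⇒ z → x * y ≤ z
    unresiduate = Equivalence.from (residuation _ _ _)

    modus-ponens : ∀ x y → (x ⇒ y) * x ≤ y
    modus-ponens x y = unresiduate ≤-refl

    *-monotonic : ∀ {x y u v} → x ≤ u → y ≤ v → x * y ≤ u * v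
    *-monotonic {x} {y} {u} {v} x≤u y≤v = begin
      x * y  ≤⟨ unresiduate (≤-trans x≤u (residuate ≤-refl)) ⟩
      u * y  ≡⟨ *-comm u y ⟩
      y * u  ≤⟨ unresiduate (≤-trans y≤v (residuate ≤-refl)) ⟩
      v * u  ≡⟨ *-comm v u ⟩
      u * v  ∎

    x*y≤x : ∀ x y → x * y ≤ x
    x*y≤x x y = begin
      x * y  ≤⟨ *-monotonic ≤-refl (⊤-top y) ⟩
      x * ⊤  ≡⟨ *-identityʳ x ⟩
      x      ∎

    x*y≤y : ∀ x y → x * y ≤ y
    x*y≤y x y = ≤-trans (≤-reflexive (*-comm x y)) (x*y≤x y x)

    x*y≤x∧y : ∀ x y → x * y ≤ x ∧ y
    x*y≤x∧y x y = ∧-greatest (x*y≤x x y) (x*y≤y x y)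

    *-distribˡ-∨ : ∀ w u v → w * (u ∨ v) ≡ w * u ∨ w * v
    *-distribˡ-∨ w u v = ≤-antisym
      (begin
        w * (u ∨ v)    ≡⟨ *-comm w (u ∨ v) ⟩
        (u ∨ v) * w    ≤⟨ unresiduate (∨-least
                            (residuate (≤-trans (≤-reflexive (*-comm u w)) (x≤x∨y _ _)))
                            (residuate (≤-trans (≤-reflexive (*-comm v w)) (y≤x∨y _ _)))) ⟩
        w * u ∨ w * v  ∎)
      (∨-least (*-monotonic ≤-refl (x≤x∨y u v)) (*-monotonic ≤-refl (y≤x∨y u v)))

    ≤-by-cover : ∀ {u v w z} → u ∨ v ≡ ⊤ → w * u ≤ z → w * v ≤ z → w ≤ z
    ≤-by-cover {u} {v} {w} {z} u∨v≡⊤ wu≤z wv≤z = begin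
      w              ≡⟨ *-identityʳ w ⟨
      w * ⊤          ≡⟨ cong (w *_) u∨v≡⊤ ⟨
      w * (u ∨ v)    ≡⟨ *-distribˡ-∨ w u v ⟩
      w * u ∨ w * v  ≤⟨ ∨-least wu≤z wv≤z ⟩
      z              ∎

    cover⇒∧≤* : ∀ {u v} → u ∨ v ≡ ⊤ → u ∧ v ≤ u * v
    cover⇒∧≤* {u} {v} u∨v≡⊤ = ≤-by-cover u∨v≡⊤
      (begin
        (u ∧ v) * u  ≡⟨ *-comm (u ∧ v) u ⟩
        u * (u ∧ v)  ≤⟨ *-monotonic ≤-refl (x∧y≤y u v) ⟩
        u * v        ∎)
      (*-monotonic (x∧y≤x u v) ≤-refl)

    x*¬x≤⊥ : ∀ x → x * ¬ x ≤ ⊥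
    x*¬x≤⊥ x = ≤-trans (≤-reflexive (*-comm x (¬ x))) (modus-ponens x ⊥)

    x≤¬¬x : ∀ x → x ≤ ¬ ¬ x
    x≤¬¬x x = residuate (x*¬x≤⊥ x)

    ¬-antitone : ∀ {x y} → x ≤ y → ¬ y ≤ ¬ x
    ¬-antitone {x} {y} x≤y = residuate (≤-trans (*-monotonic ≤-refl x≤y) (modus-ponens y ⊥))

    ¬x≤x⇒y : ∀ x y → ¬ x ≤ x ⇒ y
    ¬x≤x⇒y x y = residuate (≤-trans (modus-ponens x ⊥) (⊥-bottom y))

    ¬⊤≡⊥ : ¬ ⊤ ≡ ⊥
    ¬⊤≡⊥ = ≤⊥⇒≡⊥ (≤-trans (≤-reflexive (sym (*-identityʳ (¬ ⊤)))) (modus-ponens ⊤ ⊥))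

    ¬⊥≡⊤ : ¬ ⊥ ≡ ⊤
    ¬⊥≡⊤ = ⊤≤⇒≡⊤ (residuate (x*y≤y ⊤ ⊥))

    -- “Complemented” in the names below means  u ∨ ¬ u ≡ ⊤ , the first half of IsBoolean u.

    complemented⇒∧≡* : ∀ {u} y → u ∨ ¬ u ≡ ⊤ → u ∧ y ≡ u * y
    complemented⇒∧≡* {u} y u∨¬u≡⊤ = ≤-antisym
      (≤-by-cover u∨¬u≡⊤
        (begin
          (u ∧ y) * u  ≡⟨ *-comm (u ∧ y) u ⟩
          u * (u ∧ y)  ≤⟨ *-monotonic ≤-refl (x∧y≤y u y) ⟩
          u * y        ∎)
        (begin
          (u ∧ y) * ¬ u  ≤⟨ *-monotonic (x∧y≤x u y) ≤-refl ⟩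
          u * ¬ u        ≤⟨ x*¬x≤⊥ u ⟩
          ⊥              ≤⟨ ⊥-bottom (u * y) ⟩
          u * y          ∎))
      (x*y≤x∧y u y)

    complemented⇒Boolean : ∀ {u} → u ∨ ¬ u ≡ ⊤ → IsBoolean u
    complemented⇒Boolean {u} u∨¬u≡⊤ =
      u∨¬u≡⊤ , ≤⊥⇒≡⊥ (≤-trans (cover⇒∧≤* u∨¬u≡⊤) (x*¬x≤⊥ u))

    complemented⇒¬¬x≤x : ∀ {u} → u ∨ ¬ u ≡ ⊤ → ¬ ¬ u ≤ u
    complemented⇒¬¬x≤x {u} u∨¬u≡⊤ = ≤-by-cover u∨¬u≡⊤
      (x*y≤y (¬ ¬ u) u)
      (≤-trans (modus-ponens (¬ u) ⊥) (⊥-bottom u))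

    ≤-by-cases : ∀ {u x z} → u ∨ ¬ u ≡ ⊤ → u ∧ x ≤ z → ¬ u ∧ x ≤ z → x ≤ z
    ≤-by-cases {u} {x} u∨¬u≡⊤ ux≤z ¬ux≤z = ≤-by-cover u∨¬u≡⊤
      (≤-trans (≤-reflexive (*-comm x u)) (≤-trans (x*y≤x∧y u x) ux≤z))
      (≤-trans (≤-reflexive (*-comm x (¬ u))) (≤-trans (x*y≤x∧y (¬ u) x) ¬ux≤z))

    complemented-∧-distribˡ-∨ : ∀ {u} x y → u ∨ ¬ u ≡ ⊤ → u ∧ (x ∨ y) ≡ u ∧ x ∨ u ∧ y
    complemented-∧-distribˡ-∨ {u} x y u∨¬u≡⊤ = begin-equality
      u ∧ (x ∨ y)    ≡⟨ complemented⇒∧≡* (x ∨ y) u∨¬u≡⊤ ⟩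
      u * (x ∨ y)    ≡⟨ *-distribˡ-∨ u x y ⟩
      u * x ∨ u * y  ≡⟨ cong₂ _∨_ (complemented⇒∧≡* x u∨¬u≡⊤) (complemented⇒∧≡* y u∨¬u≡⊤) ⟨
      u ∧ x ∨ u ∧ y  ∎

    complemented-∧-*-interchange : ∀ {u v} x y → u ∨ ¬ u ≡ ⊤ → v ∨ ¬ v ≡ ⊤
      → (u ∧ v) ∨ ¬ (u ∧ v) ≡ ⊤ → (u ∧ x) * (v ∧ y) ≡ (u ∧ v) ∧ (x * y)
    complemented-∧-*-interchange {u} {v} x y u∨¬u≡⊤ v∨¬v≡⊤ u∧v∨¬u∧v≡⊤ = begin-equality
      (u ∧ x) * (v ∧ y)  ≡⟨ cong₂ _*_ (complemented⇒∧≡* x u∨¬u≡⊤) (complemented⇒∧≡* y v∨¬v≡⊤) ⟩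
      (u * x) * (v * y)  ≡⟨ *-Properties.interchange u x v y ⟩
      (u * v) * (x * y)  ≡⟨ cong (_* (x * y)) (complemented⇒∧≡* v u∨¬u≡⊤) ⟨
      (u ∧ v) * (x * y)  ≡⟨ complemented⇒∧≡* (x * y) u∧v∨¬u∧v≡⊤ ⟨
      (u ∧ v) ∧ (x * y)  ∎

    complemented-≤⇒*≡*∧ : ∀ {u x} y → u ∨ ¬ u ≡ ⊤ → x ≤ u → x * y ≡ x * (u ∧ y)
    complemented-≤⇒*≡*∧ {u} {x} y u∨¬u≡⊤ x≤u = begin-equality
      x * y        ≡⟨ cong (_* y) x≡u*x ⟩
      (u * x) * y  ≡⟨ *-Properties.xy∙z≈y∙xz u x y ⟩
      x * (u * y)  ≡⟨ cong (x *_) (complemented⇒∧≡* y u∨¬u≡⊤) ⟨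
      x * (u ∧ y)  ∎
      where
      x≡u*x : x ≡ u * x
      x≡u*x = trans (sym x≤u) (trans (∧-comm x u) (complemented⇒∧≡* x u∨¬u≡⊤))

    complemented-∧-∨-elim : ∀ {u} x y → u ∨ ¬ u ≡ ⊤ → u ≤ ¬ y → u ∧ (x ∨ y) ≤ x
    complemented-∧-∨-elim {u} x y u∨¬u≡⊤ u≤¬y = begin
      u ∧ (x ∨ y)    ≡⟨ complemented⇒∧≡* (x ∨ y) u∨¬u≡⊤ ⟩
      u * (x ∨ y)    ≡⟨ *-distribˡ-∨ u x y ⟩
      u * x ∨ u * y  ≤⟨ ∨-least (x*y≤y u x) (begin
                          u * y    ≤⟨ *-monotonic u≤¬y ≤-refl ⟩
                          ¬ y * y  ≤⟨ modus-ponens y ⊥ ⟩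
                          ⊥        ≤⟨ ⊥-bottom x ⟩
                          x        ∎) ⟩
      x              ∎

    ⊤-Boolean : IsBoolean ⊤
    ⊤-Boolean = complemented⇒Boolean (⊤≤⇒≡⊤ (x≤x∨y ⊤ (¬ ⊤)))

    ⊥-Boolean : IsBoolean ⊥
    ⊥-Boolean = complemented⇒Boolean (⊤≤⇒≡⊤ (≤-trans (≤-reflexive (sym ¬⊥≡⊤)) (y≤x∨y ⊥ (¬ ⊥))))

    dense-upward : ∀ {e y} → IsDense e → e ≤ y → IsDense y
    dense-upward ¬e≡⊥ e≤y = ≤⊥⇒≡⊥ (≤-trans (¬-antitone e≤y) (≤-reflexive ¬e≡⊥))

    dense-cancel : ∀ {x e u} → IsDense e → u ∨ ¬ u ≡ ⊤ → x ∧ e ≤ u → x ≤ u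
    dense-cancel {x} {e} {u} ¬e≡⊥ u∨¬u≡⊤ x∧e≤u = ≤-by-cover u∨¬u≡⊤ (x*y≤y x u) (begin
      x * ¬ u  ≤⟨ residuate (begin
                    (x * ¬ u) * e  ≡⟨ *-Properties.xy∙z≈xz∙y x (¬ u) e ⟩
                    (x * e) * ¬ u  ≤⟨ *-monotonic (≤-trans (x*y≤x∧y x e) x∧e≤u) ≤-refl ⟩
                    u * ¬ u        ≤⟨ x*¬x≤⊥ u ⟩
                    ⊥              ∎) ⟩
      ¬ e      ≡⟨ ¬e≡⊥ ⟩
      ⊥        ≤⟨ ⊥-bottom u ⟩
      u        ∎)

    *-dense : ∀ {e e′} → IsDense e → IsDense e′ → IsDense (e * e′)
    *-dense {e} {e′} ¬e≡⊥ ¬e′≡⊥ = ≤⊥⇒≡⊥ (begin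
      ¬ (e * e′)  ≤⟨ residuate (begin
                       ¬ (e * e′) * e  ≤⟨ residuate (begin
                                            (¬ (e * e′) * e) * e′  ≡⟨ *-assoc (¬ (e * e′)) e e′ ⟩
                                            ¬ (e * e′) * (e * e′)  ≤⟨ modus-ponens (e * e′) ⊥ ⟩
                                            ⊥                      ∎) ⟩
                       ¬ e′            ≡⟨ ¬e′≡⊥ ⟩
                       ⊥               ∎) ⟩
      ¬ e         ≡⟨ ¬e≡⊥ ⟩
      ⊥           ∎)

  ⊤ᴮ ⊥ᴮ : B A
  ⊤ᴮ = ⊤ , ⊤-Boolean
  ⊥ᴮ = ⊥ , ⊥-Boolean

  ⊤ᴰ : D A
  ⊤ᴰ = ⊤ , ¬⊤≡⊥

  infixl 7 _*ᴰ_
  infixl 6 _∧ᴰ_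
  infixl 5 _∨ᴰ_
  infixr 5 _⇒ᴰ_
  _*ᴰ_ _∧ᴰ_ _∨ᴰ_ _⇒ᴰ_ : D A → D A → D A
  (e , ¬e≡⊥) *ᴰ (e′ , ¬e′≡⊥) = e * e′ , *-dense ¬e≡⊥ ¬e′≡⊥
  (e , ¬e≡⊥) ∧ᴰ (e′ , ¬e′≡⊥) = e ∧ e′ , dense-upward (*-dense ¬e≡⊥ ¬e′≡⊥) (x*y≤x∧y e e′)
  (e , ¬e≡⊥) ∨ᴰ (e′ , _)     = e ∨ e′ , dense-upward ¬e≡⊥ (x≤x∨y e e′)
  (e , _)    ⇒ᴰ (e′ , ¬e′≡⊥) = e ⇒ e′ , dense-upward ¬e′≡⊥ (residuate (x*y≤x e′ e))

module StoneanProperties {c : Level} (A : BoundedResLattice c) (stonean : IsStonean A) where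
  open BoundedResLattice A hiding (Carrier; B; D)
  open ResiduatedLatticeProperties A
  open ≤-Reasoning

  opaque
    ¬-Boolean : ∀ x → IsBoolean (¬ x)
    ¬-Boolean x = complemented⇒Boolean (stonean x)

    ∧-Boolean : ∀ {u v} → u ∨ ¬ u ≡ ⊤ → v ∨ ¬ v ≡ ⊤ → IsBoolean (u ∧ v)
    ∧-Boolean {u} {v} u∨¬u≡⊤ v∨¬v≡⊤ = complemented⇒Boolean (⊤≤⇒≡⊤ (begin
      ⊤                        ≡⟨ stonean (u ∧ v) ⟨
      ¬ (u ∧ v) ∨ ¬ ¬ (u ∧ v)  ≤⟨ ∨-monotonic ≤-refl (∧-greatest
                                    (≤-trans (¬¬-monotonic (x∧y≤x u v)) (complemented⇒¬¬x≤x u∨¬u≡⊤))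
                                    (≤-trans (¬¬-monotonic (x∧y≤y u v)) (complemented⇒¬¬x≤x v∨¬v≡⊤))) ⟩
      ¬ (u ∧ v) ∨ (u ∧ v)      ≡⟨ ∨-comm (¬ (u ∧ v)) (u ∧ v) ⟩
      (u ∧ v) ∨ ¬ (u ∧ v)      ∎))
      where
      ¬¬-monotonic : ∀ {x y} → x ≤ y → ¬ ¬ x ≤ ¬ ¬ y
      ¬¬-monotonic x≤y = ¬-antitone (¬-antitone x≤y)

    x∨¬x-dense : ∀ x → IsDense (x ∨ ¬ x)
    x∨¬x-dense x = ≤⊥⇒≡⊥ (begin
      ¬ (x ∨ ¬ x)    ≤⟨ ∧-greatest (¬-antitone (x≤x∨y x (¬ x))) (¬-antitone (y≤x∨y x (¬ x))) ⟩
      ¬ x ∧ ¬ ¬ x    ≤⟨ cover⇒∧≤* (stonean x) ⟩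
      ¬ x * ¬ ¬ x    ≤⟨ x*¬x≤⊥ (¬ x) ⟩
      ⊥              ∎)

    decomposition : ∀ x → ¬ ¬ x ∧ (x ∨ ¬ x) ≡ x
    decomposition x = ≤-antisym
      (complemented-∧-∨-elim x (¬ x) (stonean (¬ x)) ≤-refl)
      (∧-greatest (x≤¬¬x x) (x≤x∨y x (¬ x)))

  booleanPart : Carrier A → B A
  booleanPart x = ¬ ¬ x , ¬-Boolean (¬ x)

  densePart : Carrier A → D A
  densePart x = x ∨ ¬ x , x∨¬x-dense x

  ¬ᴮ_ : B A → B A
  ¬ᴮ (u , _) = ¬ u , ¬-Boolean u

  infixl 6 _∧ᴮ_
  _∧ᴮ_ : B A → B A → B A
  (u , u∨¬u≡⊤ , _) ∧ᴮ (v , v∨¬v≡⊤ , _) = u ∧ v , ∧-Boolean u∨¬u≡⊤ v∨¬v≡⊤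

module Extension {a b : Level} (A₁ : BoundedResLattice a) (A₂ : BoundedResLattice b)
  (stonean₁ : IsStonean A₁) (m : TMorphism A₁ A₂) where
  private
    module A₁ = BoundedResLattice A₁
    module A₂ = BoundedResLattice A₂
    module R₁ = ResiduatedLatticeProperties A₁
    module R₂ = ResiduatedLatticeProperties A₂
    module S₁ = StoneanProperties A₁ stonean₁
  open A₁ using () renaming
    (_∧_ to _∧₁_; _∨_ to _∨₁_; _*_ to _*₁_; _⇒_ to _⇒₁_; ¬_ to ¬₁_; _≤_ to _≤₁_; ⊤ to ⊤₁; ⊥ to ⊥₁)
  open A₂ using () renaming
    (_∧_ to _∧₂_; _∨_ to _∨₂_; _*_ to _*₂_; _⇒_ to _⇒₂_; ¬_ to ¬₂_; _≤_ to _≤₂_; ⊤ to ⊤₂; ⊥ to ⊥₂)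
  open R₁ using (⊤ᴮ; ⊥ᴮ; ⊤ᴰ; _*ᴰ_; _∧ᴰ_; _∨ᴰ_; _⇒ᴰ_)
  open S₁ using (booleanPart; densePart; ¬ᴮ_; _∧ᴮ_; decomposition)
  open TMorphism m

  H : B A₁ → Carrier A₂
  H p = proj₁ (h p)

  K : D A₁ → Carrier A₂
  K e = proj₁ (k e)

  H-complemented : ∀ p → H p ∨₂ ¬₂ H p ≡ ⊤₂
  H-complemented p = proj₁ (proj₂ (h p))

  H-∧ : ∀ p q → H (p ∧ᴮ q) ≡ H p ∧₂ H q
  H-∧ p q = proj₁ (proj₂ h-hom) p q (p ∧ᴮ q) refl

  H-¬ : ∀ p → H (¬ᴮ p) ≡ ¬₂ H p
  H-¬ p = proj₁ (proj₂ (proj₂ h-hom)) p (¬ᴮ p) refl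

  H-⊤ : H ⊤ᴮ ≡ ⊤₂
  H-⊤ = proj₁ (proj₂ (proj₂ (proj₂ h-hom))) ⊤ᴮ refl

  H-⊥ : H ⊥ᴮ ≡ ⊥₂
  H-⊥ = proj₂ (proj₂ (proj₂ (proj₂ h-hom))) ⊥ᴮ refl

  K-* : ∀ e ε → K (e *ᴰ ε) ≡ K e *₂ K ε
  K-* e ε = proj₁ k-hom e ε (e *ᴰ ε) refl

  K-⇒ : ∀ e ε → K (e ⇒ᴰ ε) ≡ K e ⇒₂ K ε
  K-⇒ e ε = proj₁ (proj₂ k-hom) e ε (e ⇒ᴰ ε) refl

  K-∨ : ∀ e ε → K (e ∨ᴰ ε) ≡ K e ∨₂ K ε
  K-∨ e ε = proj₁ (proj₂ (proj₂ k-hom)) e ε (e ∨ᴰ ε) refl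

  K-∧ : ∀ e ε → K (e ∧ᴰ ε) ≡ K e ∧₂ K ε
  K-∧ e ε = proj₁ (proj₂ (proj₂ (proj₂ k-hom))) e ε (e ∧ᴰ ε) refl

  K-⊤ : K ⊤ᴰ ≡ ⊤₂
  K-⊤ = proj₂ (proj₂ (proj₂ (proj₂ k-hom))) ⊤ᴰ refl

  H-monotonic : ∀ p q → proj₁ p ≤₁ proj₁ q → H p ≤₂ H q
  H-monotonic p q p≤q = sym (proj₁ (proj₂ h-hom) p q p (sym p≤q))

  f : Carrier A₁ → Carrier A₂
  f x = H (booleanPart x) ∧₂ K (densePart x)

  H∧K≤K : ∀ p e ε → proj₁ p ∧₁ proj₁ e ≤₁ proj₁ ε → H p ∧₂ K e ≤₂ K ε
  H∧K≤K p e ε p∧e≤ε = begin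
    H p ∧₂ K e          ≡⟨ R₂.complemented⇒∧≡* (K e) (H-complemented p) ⟩
    H p *₂ K e          ≤⟨ R₂.unresiduate (begin
                             H p              ≤⟨ R₂.x≤¬¬x (H p) ⟩
                             ¬₂ ¬₂ H p        ≡⟨ cong ¬₂_ (H-¬ p) ⟨
                             ¬₂ H (¬ᴮ p)      ≤⟨ compat (¬ᴮ p) (e ⇒ᴰ ε) e⇒ε∈φ¬p ⟩
                             K (e ⇒ᴰ ε)       ≡⟨ K-⇒ e ε ⟩
                             K e ⇒₂ K ε       ∎) ⟩
    K ε                 ∎
    where
    open R₂.≤-Reasoning
    e⇒ε∈φ¬p : (e ⇒ᴰ ε) A₁.∈φ (¬ᴮ p)
    e⇒ε∈φ¬p = R₁.≤-trans (R₁.complemented⇒¬¬x≤x (proj₁ (proj₂ p)))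
                          (R₁.residuate (R₁.≤-trans (R₁.x*y≤x∧y _ _) p∧e≤ε))

  H∧K-monotonic : ∀ p q e ε → proj₁ p ∧₁ proj₁ e ≤₁ proj₁ q ∧₁ proj₁ ε → H p ∧₂ K e ≤₂ H q ∧₂ K ε
  H∧K-monotonic p q e ε p∧e≤q∧ε = R₂.∧-greatest
    (R₂.≤-trans (R₂.x∧y≤x (H p) (K e)) (H-monotonic p q
      (R₁.dense-cancel (proj₂ e) (proj₁ (proj₂ q)) (R₁.≤-trans p∧e≤q∧ε (R₁.x∧y≤x _ _)))))
    (H∧K≤K p e ε (R₁.≤-trans p∧e≤q∧ε (R₁.x∧y≤y _ _)))

  -- p and e need not be the Boolean and dense parts of x, yet f x is determined by them.
  f-Boolean∧dense : ∀ p e {x} → proj₁ p ∧₁ proj₁ e ≡ x → f x ≡ H p ∧₂ K e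
  f-Boolean∧dense p e {x} p∧e≡x = R₂.≤-antisym
    (H∧K-monotonic (booleanPart x) p (densePart x) e (R₁.≤-reflexive (trans (decomposition x) (sym p∧e≡x))))
    (H∧K-monotonic p (booleanPart x) e (densePart x) (R₁.≤-reflexive (trans p∧e≡x (sym (decomposition x)))))

  f-extends-h : ∀ p → f (proj₁ p) ≡ H p
  f-extends-h p = begin
    f (proj₁ p)  ≡⟨ f-Boolean∧dense p ⊤ᴰ (R₁.∧-identityʳ (proj₁ p)) ⟩
    H p ∧₂ K ⊤ᴰ  ≡⟨ cong (H p ∧₂_) K-⊤ ⟩
    H p ∧₂ ⊤₂    ≡⟨ R₂.∧-identityʳ (H p) ⟩
    H p          ∎
    where open ≡-Reasoning

  f-extends-k : ∀ e → f (proj₁ e) ≡ K e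
  f-extends-k e = begin
    f (proj₁ e)  ≡⟨ f-Boolean∧dense ⊤ᴮ e (R₁.∧-identityˡ (proj₁ e)) ⟩
    H ⊤ᴮ ∧₂ K e  ≡⟨ cong (_∧₂ K e) H-⊤ ⟩
    ⊤₂ ∧₂ K e    ≡⟨ R₂.∧-identityˡ (K e) ⟩
    K e          ∎
    where open ≡-Reasoning

  f-⊤ : f ⊤₁ ≡ ⊤₂
  f-⊤ = trans (f-extends-h ⊤ᴮ) H-⊤

  f-⊥ : f ⊥₁ ≡ ⊥₂
  f-⊥ = trans (f-extends-h ⊥ᴮ) H-⊥

  f-∧ : ∀ x y → f (x ∧₁ y) ≡ f x ∧₂ f y
  f-∧ x y = begin
    f (x ∧₁ y)                    ≡⟨ f-Boolean∧dense (p ∧ᴮ q) (d ∧ᴰ e) parts ⟩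
    H (p ∧ᴮ q) ∧₂ K (d ∧ᴰ e)      ≡⟨ cong₂ _∧₂_ (H-∧ p q) (K-∧ d e) ⟩
    (H p ∧₂ H q) ∧₂ (K d ∧₂ K e)  ≡⟨ R₂.∧-Properties.interchange (H p) (H q) (K d) (K e) ⟩
    f x ∧₂ f y                    ∎
    where
    open ≡-Reasoning
    p = booleanPart x
    q = booleanPart y
    d = densePart x
    e = densePart y
    parts : (proj₁ p ∧₁ proj₁ q) ∧₁ (proj₁ d ∧₁ proj₁ e) ≡ x ∧₁ y
    parts = trans (R₁.∧-Properties.interchange (proj₁ p) (proj₁ q) (proj₁ d) (proj₁ e))
                  (cong₂ _∧₁_ (decomposition x) (decomposition y))

  f-monotonic : ∀ {x y} → x ≤₁ y → f x ≤₂ f y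
  f-monotonic {x} {y} x≤y = trans (sym (f-∧ x y)) (cong f x≤y)

  f-* : ∀ x y → f (x *₁ y) ≡ f x *₂ f y
  f-* x y = begin
    f (x *₁ y)                    ≡⟨ f-Boolean∧dense (p ∧ᴮ q) (d *ᴰ e) parts ⟩
    H (p ∧ᴮ q) ∧₂ K (d *ᴰ e)      ≡⟨ cong₂ _∧₂_ (H-∧ p q) (K-* d e) ⟩
    (H p ∧₂ H q) ∧₂ (K d *₂ K e)  ≡⟨ R₂.complemented-∧-*-interchange (K d) (K e)
                                       (H-complemented p) (H-complemented q) Hp∧Hq-complemented ⟨
    f x *₂ f y                    ∎
    where
    open ≡-Reasoning
    p = booleanPart x
    q = booleanPart y
    d = densePart x
    e = densePart y
    parts : (proj₁ p ∧₁ proj₁ q) ∧₁ (proj₁ d *₁ proj₁ e) ≡ x *₁ y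
    parts = trans (sym (R₁.complemented-∧-*-interchange (proj₁ d) (proj₁ e)
                         (proj₁ (proj₂ p)) (proj₁ (proj₂ q)) (proj₁ (proj₂ (p ∧ᴮ q)))))
                  (cong₂ _*₁_ (decomposition x) (decomposition y))
    Hp∧Hq-complemented : (H p ∧₂ H q) ∨₂ ¬₂ (H p ∧₂ H q) ≡ ⊤₂
    Hp∧Hq-complemented = subst (λ z → z ∨₂ ¬₂ z ≡ ⊤₂) (H-∧ p q) (H-complemented (p ∧ᴮ q))

  f-≤-by-cases : ∀ p {x z} → f (proj₁ p ∧₁ x) ≤₂ z → f (¬₁ proj₁ p ∧₁ x) ≤₂ z → f x ≤₂ z
  f-≤-by-cases p {x} {z} p∧x≤z ¬p∧x≤z = R₂.≤-by-cases (H-complemented p)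
    (subst (_≤₂ z) (trans (f-∧ (proj₁ p) x) (cong (_∧₂ f x) (f-extends-h p))) p∧x≤z)
    (subst (_≤₂ z) (trans (f-∧ (¬₁ proj₁ p) x) (cong (_∧₂ f x) (trans (f-extends-h (¬ᴮ p)) (H-¬ p)))) ¬p∧x≤z)

  f-∨ : ∀ x y → f (x ∨₁ y) ≡ f x ∨₂ f y
  f-∨ x y = R₂.≤-antisym
    (f-≤-by-cases p (f-≤-by-cases q below-p∧q below-p∧¬q) below-¬p)
    (R₂.∨-least (f-monotonic (R₁.x≤x∨y x y)) (f-monotonic (R₁.y≤x∨y x y)))
    where
    p = booleanPart x
    q = booleanPart y
    d = densePart x
    e = densePart y
    below-¬p : f (¬₁ proj₁ p ∧₁ (x ∨₁ y)) ≤₂ f x ∨₂ f y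
    below-¬p = R₂.≤-trans
      (f-monotonic (R₁.≤-trans (R₁.≤-reflexive (cong (¬₁ proj₁ p ∧₁_) (R₁.∨-comm x y)))
                               (R₁.complemented-∧-∨-elim y x (stonean₁ (proj₁ p)) (R₁.¬-antitone (R₁.x≤¬¬x x)))))
      (R₂.y≤x∨y (f x) (f y))
    below-p∧¬q : f (¬₁ proj₁ q ∧₁ (proj₁ p ∧₁ (x ∨₁ y))) ≤₂ f x ∨₂ f y
    below-p∧¬q = R₂.≤-trans
      (f-monotonic (R₁.≤-trans (R₁.∧-monotonic R₁.≤-refl (R₁.x∧y≤y (proj₁ p) (x ∨₁ y)))
                               (R₁.complemented-∧-∨-elim x y (stonean₁ (proj₁ q)) (R₁.¬-antitone (R₁.x≤¬¬x y)))))
      (R₂.x≤x∨y (f x) (f y))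
    below-p∧q : f (proj₁ q ∧₁ (proj₁ p ∧₁ (x ∨₁ y))) ≤₂ f x ∨₂ f y
    below-p∧q = begin
      f (proj₁ q ∧₁ (proj₁ p ∧₁ (x ∨₁ y)))  ≤⟨ f-monotonic (R₁.≤-trans
                                                 (R₁.∧-monotonic R₁.≤-refl (R₁.∧-monotonic R₁.≤-refl
                                                   (R₁.∨-monotonic (R₁.x≤x∨y x (¬₁ x)) (R₁.x≤x∨y y (¬₁ y)))))
                                                 (R₁.≤-reflexive (R₁.∧-Properties.x∙yz≈yx∙z _ _ _))) ⟩
      f ((proj₁ p ∧₁ proj₁ q) ∧₁ (proj₁ d ∨₁ proj₁ e))
                                            ≡⟨ f-Boolean∧dense (p ∧ᴮ q) (d ∨ᴰ e) refl ⟩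
      H (p ∧ᴮ q) ∧₂ K (d ∨ᴰ e)              ≡⟨ cong (H (p ∧ᴮ q) ∧₂_) (K-∨ d e) ⟩
      H (p ∧ᴮ q) ∧₂ (K d ∨₂ K e)            ≡⟨ R₂.complemented-∧-distribˡ-∨ (K d) (K e) (H-complemented (p ∧ᴮ q)) ⟩
      H (p ∧ᴮ q) ∧₂ K d ∨₂ H (p ∧ᴮ q) ∧₂ K e
                                            ≤⟨ R₂.∨-monotonic
                                                 (R₂.∧-monotonic (H-monotonic (p ∧ᴮ q) p (R₁.x∧y≤x _ _)) R₂.≤-refl)
                                                 (R₂.∧-monotonic (H-monotonic (p ∧ᴮ q) q (R₁.x∧y≤y _ _)) R₂.≤-refl) ⟩
      f x ∨₂ f y                            ∎
      where open R₂.≤-Reasoning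

  ⇒-elim-densePart : ∀ x y {s} → s ≤₂ H (booleanPart x) → s ≤₂ f x ⇒₂ f y → s *₂ K (densePart x) ≤₂ f y
  ⇒-elim-densePart x y {s} s≤Hp s≤f⇒ = begin
    s *₂ K (densePart x)   ≡⟨ R₂.complemented-≤⇒*≡*∧ (K (densePart x)) (H-complemented (booleanPart x)) s≤Hp ⟩
    s *₂ f x               ≤⟨ R₂.*-monotonic s≤f⇒ R₂.≤-refl ⟩
    (f x ⇒₂ f y) *₂ f x    ≤⟨ R₂.modus-ponens (f x) (f y) ⟩
    f y                    ∎
    where open R₂.≤-Reasoning

  f-⇒-case-¬p : ∀ x y → ¬₂ H (booleanPart x) ∧₂ (f x ⇒₂ f y) ≤₂ f (x ⇒₁ y)
  f-⇒-case-¬p x y = begin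
    ¬₂ H p ∧₂ (f x ⇒₂ f y)  ≤⟨ R₂.x∧y≤x (¬₂ H p) (f x ⇒₂ f y) ⟩
    ¬₂ H p                  ≡⟨ trans (f-extends-h (¬ᴮ p)) (H-¬ p) ⟨
    f (¬₁ ¬₁ ¬₁ x)          ≤⟨ f-monotonic (R₁.≤-trans (R₁.¬-antitone (R₁.x≤¬¬x x)) (R₁.¬x≤x⇒y x y)) ⟩
    f (x ⇒₁ y)              ∎
    where
    open R₂.≤-Reasoning
    p = booleanPart x

  f-⇒-case-p∧q : ∀ x y → H (booleanPart y) ∧₂ (H (booleanPart x) ∧₂ (f x ⇒₂ f y)) ≤₂ f (x ⇒₁ y)
  f-⇒-case-p∧q x y = begin
    H q ∧₂ (H p ∧₂ (f x ⇒₂ f y))  ≤⟨ R₂.∧-greatest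
                                      (R₂.∧-greatest (R₂.≤-trans (R₂.x∧y≤y _ _) (R₂.x∧y≤x _ _)) (R₂.x∧y≤x _ _))
                                      (R₂.residuate (R₂.≤-trans
                                        (⇒-elim-densePart x y (R₂.≤-trans (R₂.x∧y≤y _ _) (R₂.x∧y≤x _ _))
                                                              (R₂.≤-trans (R₂.x∧y≤y _ _) (R₂.x∧y≤y _ _)))
                                        (R₂.x∧y≤y (H q) (K e)))) ⟩
    (H p ∧₂ H q) ∧₂ (K d ⇒₂ K e)  ≡⟨ cong₂ _∧₂_ (H-∧ p q) (K-⇒ d e) ⟨
    H (p ∧ᴮ q) ∧₂ K (d ⇒ᴰ e)      ≡⟨ f-Boolean∧dense (p ∧ᴮ q) (d ⇒ᴰ e) refl ⟨
    f ((proj₁ p ∧₁ proj₁ q) ∧₁ (proj₁ d ⇒₁ proj₁ e))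
                                  ≤⟨ f-monotonic (R₁.residuate (R₁.≤-trans (R₁.∧-greatest
                                       (R₁.≤-trans (R₁.x*y≤x _ _) (R₁.≤-trans (R₁.x∧y≤x _ _) (R₁.x∧y≤y _ _)))
                                       (R₁.≤-trans (R₁.*-monotonic (R₁.x∧y≤y _ _) (R₁.x≤x∨y x (¬₁ x)))
                                                   (R₁.modus-ponens _ _)))
                                       (R₁.≤-reflexive (decomposition y)))) ⟩
    f (x ⇒₁ y)                    ∎
    where
    open R₂.≤-Reasoning
    p = booleanPart x
    q = booleanPart y
    d = densePart x
    e = densePart y

  f-⇒-case-p∧¬q : ∀ x y → ¬₂ H (booleanPart y) ∧₂ (H (booleanPart x) ∧₂ (f x ⇒₂ f y)) ≤₂ f (x ⇒₁ y)
  f-⇒-case-p∧¬q x y = begin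
    s         ≤⟨ R₂.residuate (begin
                   s *₂ K d        ≤⟨ R₂.∧-greatest
                                        (R₂.≤-trans (R₂.x*y≤x _ _) (R₂.x∧y≤x _ _))
                                        (R₂.≤-trans (⇒-elim-densePart x y (R₂.≤-trans (R₂.x∧y≤y _ _) (R₂.x∧y≤x _ _))
                                                                          (R₂.≤-trans (R₂.x∧y≤y _ _) (R₂.x∧y≤y _ _)))
                                                    (R₂.x∧y≤x (H q) (K (densePart y)))) ⟩
                   ¬₂ H q ∧₂ H q   ≡⟨ trans (R₂.∧-comm (¬₂ H q) (H q)) (proj₂ (proj₂ (h q))) ⟩
                   ⊥₂              ∎) ⟩
    ¬₂ K d    ≡⟨ proj₂ (k d) ⟩
    ⊥₂        ≤⟨ A₂.⊥-bottom (f (x ⇒₁ y)) ⟩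
    f (x ⇒₁ y) ∎
    where
    open R₂.≤-Reasoning
    q = booleanPart y
    d = densePart x
    s = ¬₂ H q ∧₂ (H (booleanPart x) ∧₂ (f x ⇒₂ f y))

  f-⇒ : ∀ x y → f (x ⇒₁ y) ≡ f x ⇒₂ f y
  f-⇒ x y = R₂.≤-antisym
    (R₂.residuate (begin
      f (x ⇒₁ y) *₂ f x  ≡⟨ f-* (x ⇒₁ y) x ⟨
      f ((x ⇒₁ y) *₁ x)  ≤⟨ f-monotonic (R₁.modus-ponens x y) ⟩
      f y                ∎))
    (R₂.≤-by-cases (H-complemented (booleanPart x))
      (R₂.≤-by-cases (H-complemented (booleanPart y)) (f-⇒-case-p∧q x y) (f-⇒-case-p∧¬q x y))
      (f-⇒-case-¬p x y))
    where open R₂.≤-Reasoning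

-- A₂ need not be Stonean: the only complemented elements of A₂ the proof uses are values of h.
corollary3p11 : {a b : Level} (A₁ : BoundedResLattice a) (A₂ : BoundedResLattice b)
    → IsStonean A₁ → IsStonean A₂
    → (m : TMorphism A₁ A₂)
    → Σ (Carrier A₁ → Carrier A₂) (λ f →
        IsBRLHom A₁ A₂ f
        × (∀ (x : B A₁) → f (proj₁ x) ≡ proj₁ (TMorphism.h m x))
        × (∀ (x : D A₁) → f (proj₁ x) ≡ proj₁ (TMorphism.k m x)))
corollary3p11 A₁ A₂ stonean₁ _ m =
  f , (f-* , f-⇒ , f-∨ , f-∧ , f-⊤ , f-⊥) , f-extends-h , f-extends-k
  where open Extension A₁ A₂ stonean₁ m
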